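{- Let $G=(V,E)$ be a finite simple graph and let $T$ be a positive integer. Let $(s,x,y,z)$ be a feasible solution of the Infection Model $\mathrm{IM}(G,T)$, i.e. $s\in\{0,1\}^V$, $x\in\{0,1,\ldots,T\}^V$, $y\in\{0,1\}^A$, $z\in\{0,1,\ldots,T\}$ satisfy (i) $s_v+\sum_{a=(u,v)\in A}y_a=1$ for all $v\in V$; (ii) $x_u-x_v+(T+1)y_a\le T$ for all $a=(u,v)\in A$; (iii) $x_w-x_v+(T+1)y_a\le T$ for all $a=(u,v)\in A$ and all $w\in N(u)\setminus\{v\}$; (iv) $x_v-z\le 0$ for all $v\in V$. Then $C=\{v\in V: s_v=1\}$ is a zero forcing set of $G$ corresponding to a zero forcing game in $\mathcal{Z}(G,T)$, and $\operatorname{pt}(G,C)\le z\le T$.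
   Context: $G=(V,E)$ is a finite simple graph, $N(u)$ denotes the set of neighbors of $u$, and $A$ is the set of arcs obtained by including both $(u,v)$ and $(v,u)$ for every edge $\{u,v\}\in E$. Zero forcing uses the standard color change rule: a filled vertex $u$ can force a non-filled vertex $v$ if $v$ is the only non-filled neighbor of $u$. A zero forcing game with initial set $C$ is a collection of sets $C^{(t)}$, $C^{[t]}$ ($t\ge 0$) and a collection of forces $u\to v$, with $C=C^{(0)}=C^{[0]}$, $C^{[t]}=C^{[t-1]}\cup C^{(t)}$, such that every vertex lies in exactly one $C^{(t)}$, and each $v\in C^{(t)}$ with $t\ge1$ is forced by exactly one neighbor $u$ for which $u$ and all neighbors of $u$ other than $v$ lie in $C^{[t-1]}$ (in this game not every available force need be applied at each step). $C$ is a zero forcing set if repeated application of the rule starting from $C$ fills all of $V$. $\mathcal{Z}(G,T)$ is the family of zero forcing games on $G$ whose initial set is a zero forcing set and which fill all vertices using at most $T$ time steps. The propagation time $\operatorname{pt}(G,C)$ of a zero forcing set $C$ is the smallest $t^*$ such that all vertices are filled after $t^*$ time steps when at each time step all possible forces are applied simultaneously (and $\infty$ if $C$ is not a zero forcing set). -}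

module Defs where

open import Data.Nat using (ℕ; zero; suc; _+_; _*_; _≤_; _<_; _≡ᵇ_)
open import Data.Bool using (Bool; true; false; _∧_; _∨_; not; if_then_else_; T)
open import Data.Fin using (Fin; _≟_)
open import Data.List using (List; map; allFin)
open import Data.Bool.ListAction using (all; any)
open import Data.Nat.ListAction using (sum)
open import Data.Empty using (⊥)
open import Relation.Nullary using (¬_)
open import Data.Product using (Σ; ∃; _×_; _,_)
open import Relation.Nullary.Decidable using (⌊_⌋)
open import Relation.Binary.PropositionalEquality using (_≡_; _≢_)
open import Function.Bundles using (_⇔_)

record Graph : Set where
  field
    n      : ℕ
    adj    : Fin n → Fin n → Bool
    sym    : ∀ u v → adj u v ≡ adj v u
    irrefl : ∀ v → adj v v ≡ false

module _ (G : Graph) where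
  open Graph G

  Vertex : Set
  Vertex = Fin n

  -- u and v adjacent, i.e. (u , v) is an arc of A
  Adj : Vertex → Vertex → Set
  Adj u v = adj u v ≡ true

  VSet : Set
  VSet = Vertex → Bool

  canForce : VSet → Vertex → Vertex → Bool
  canForce F u v =
    F u ∧ adj u v ∧ all (λ w → not (adj u w) ∨ ⌊ w ≟ v ⌋ ∨ F w) (allFin n)

  step : VSet → VSet
  step F v = F v ∨ any (λ u → canForce F u v) (allFin n)

  filledAfter : ℕ → VSet → VSet
  filledAfter zero    F = F
  filledAfter (suc t) F = step (filledAfter t F)

  AllFilled : VSet → Set
  AllFilled F = ∀ v → F v ≡ true

  IsZeroForcingSet : VSet → Set
  IsZeroForcingSet C = ∃ λ k → AllFilled (filledAfter k C)

  IsPropagationTime : VSet → ℕ → Set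
  IsPropagationTime C t =
    AllFilled (filledAfter t C) × (∀ t' → t' < t → ¬ AllFilled (filledAfter t' C))

  -- A zero forcing game with initial set C: τ v is the unique t with
  -- v ∈ C^(t); forcer v h is the unique u with u → v (for τ v ≥ 1).
  record ZFGame (C : VSet) : Set where
    field
      τ       : Vertex → ℕ
      initial : ∀ v → τ v ≡ 0 ⇔ C v ≡ true
      forcer  : (v : Vertex) → 1 ≤ τ v → Vertex
      forcer-adj  : ∀ v (h : 1 ≤ τ v) → Adj (forcer v h) v
      forcer-time : ∀ v (h : 1 ≤ τ v) → τ (forcer v h) < τ v
      forcer-nbrs : ∀ v (h : 1 ≤ τ v) (w : Vertex) →
                    Adj (forcer v h) w → w ≢ v → τ w < τ v

  InZ : ∀ {C} → ℕ → ZFGame C → Set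
  InZ {C} T g = IsZeroForcingSet C × (∀ v → ZFGame.τ g v ≤ T)

  inSum : (Vertex → Vertex → ℕ) → Vertex → ℕ
  inSum y v = sum (map (λ u → if adj u v then y u v else 0) (allFin n))

  -- feasible solution of IM(G,T); subtractions moved across (ℕ-arithmetic)
  record FeasibleIM (T : ℕ) (s : Vertex → ℕ) (x : Vertex → ℕ)
                    (y : Vertex → Vertex → ℕ) (z : ℕ) : Set where
    field
      s-bin : ∀ v → s v ≤ 1
      x-rng : ∀ v → x v ≤ T
      y-bin : ∀ u v → Adj u v → y u v ≤ 1
      z-rng : z ≤ T
      c1 : ∀ v → s v + inSum y v ≡ 1
      c2 : ∀ u v → Adj u v → x u + (suc T) * y u v ≤ T + x v
      c3 : ∀ u v → Adj u v → ∀ w → Adj u w → w ≢ v →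
           x w + (suc T) * y u v ≤ T + x v
      c4 : ∀ v → x v ≤ z

  supportSet : (Vertex → ℕ) → VSet
  supportSet s v = s v ≡ᵇ 1

{-# OPTIONS --safe #-}
-- A vertex v outside C has, by (i), an in-arc (u, v) with y = 1, and then (ii) and (iii)
-- say x_u < x_v and x_w < x_v for every other neighbour w of u.  So in the game where v
-- is filled at time x_v by u, every force is legal; inducting on t, every vertex with
-- x_v ≤ t is filled after t rounds of simultaneous forcing, hence everything after z ≤ T.
module Submission where

open import Defs
open import Data.Nat using (ℕ; zero; suc; _+_; _*_; _≤_; _<_; z≤n; s≤s; _≡ᵇ_)
open import Data.Nat.Properties
  using (≤-refl; ≤-trans; ≤-<-trans; <-≤-trans; ≤-pred; m≤n⇒m≤1+n; m≤n⇒m<n∨m≡n; n≮0;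
         +-suc; +-comm; +-monoʳ-≤; +-cancelʳ-≤; m≤m*n; module ≤-Reasoning)
open import Data.Bool using (Bool; true; false; not; _∨_; if_then_else_)
open import Data.Bool.Properties using (∨-zeroʳ; T-≡; not-¬) renaming (_≟_ to _≟ᵇ_)
open import Data.Bool.ListAction using (all; any)
open import Data.Nat.ListAction using (sum)
open import Data.List using (List; []; _∷_; map; allFin)
open import Data.List.Relation.Unary.Any as Any using ()
open import Data.List.Relation.Unary.All as All using ()
open import Data.List.Relation.Unary.Any.Properties using (any⁺)
open import Data.List.Relation.Unary.All.Properties using (all⁻)
open import Data.List.Membership.Propositional using (_∈_)
open import Data.List.Membership.Propositional.Properties using (∈-allFin)
open import Data.Fin using (_≟_)
open import Data.Fin.Properties using (all?)
open import Data.Product using (Σ; ∃; _×_; _,_)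
open import Data.Sum using (_⊎_; inj₁; inj₂)
open import Data.Empty using (⊥-elim)
open import Relation.Nullary using (¬_; yes; no)
open import Relation.Nullary.Decidable using (⌊_⌋)
open import Relation.Unary using (Pred; Decidable)
open import Relation.Binary.PropositionalEquality using (_≡_; _≢_; refl; sym; trans; cong; subst)
open import Function.Bundles using (_⇔_; Equivalence; mk⇔)

open Equivalence using (to; from)

any-true : ∀ {A : Set} (p : A → Bool) {xs : List A} {u : A} →
           u ∈ xs → p u ≡ true → any p xs ≡ true
any-true p u∈xs pu = T-≡ .to (any⁺ p (Any.map (λ { refl → T-≡ .from pu }) u∈xs))

all-true : ∀ {A : Set} (p : A → Bool) (xs : List A) →
           (∀ u → p u ≡ true) → all p xs ≡ true
all-true p xs h = T-≡ .to (all⁻ p {xs = xs} (All.tabulate (λ {u} _ → T-≡ .from (h u))))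

sum-map-positive : ∀ {A : Set} (f : A → ℕ) (xs : List A) →
                   0 < sum (map f xs) → ∃ λ u → 0 < f u
sum-map-positive f []       ()
sum-map-positive f (u ∷ us) pos with f u in fu
... | zero  = sum-map-positive f us pos
... | suc _ = u , subst (0 <_) (sym fu) (s≤s z≤n)

m+[1+k]*y≤k+n⇒m<n : ∀ m n k {y} → 0 < y → m + suc k * y ≤ k + n → m < n
m+[1+k]*y≤k+n⇒m<n m n k {y@(suc _)} _ h = +-cancelʳ-≤ k (suc m) n (begin
  suc m + k      ≡⟨ +-suc m k ⟨
  m + suc k      ≤⟨ +-monoʳ-≤ m (m≤m*n (suc k) y) ⟩
  m + suc k * y  ≤⟨ h ⟩
  k + n          ≡⟨ +-comm k n ⟩
  n + k          ∎)
  where open ≤-Reasoning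

IsLeast : ∀ {p} → Pred ℕ p → ℕ → Set p
IsLeast P m = P m × (∀ t → t < m → ¬ P t)

module _ {p} {P : Pred ℕ p} (P? : Decidable P) where

  least-≤-or-none : ∀ z → (∃ λ m → IsLeast P m × m ≤ z) ⊎ (∀ t → t ≤ z → ¬ P t)
  least-≤-or-none zero with P? zero
  ... | yes P0 = inj₁ (zero , (P0 , λ _ ()) , z≤n)
  ... | no ¬P0 = inj₂ λ { zero z≤n → ¬P0 }
  least-≤-or-none (suc z) with least-≤-or-none z
  ... | inj₁ (m , least , m≤z) = inj₁ (m , least , m≤n⇒m≤1+n m≤z)
  ... | inj₂ none with P? (suc z)
  ...   | yes Psz = inj₁ (suc z , (Psz , λ t t<sz → none t (≤-pred t<sz)) , ≤-refl)
  ...   | no ¬Psz = inj₂ none′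
    where
    none′ : ∀ t → t ≤ suc z → ¬ P t
    none′ t t≤sz with m≤n⇒m<n∨m≡n t≤sz
    ... | inj₁ t<sz = none t (≤-pred t<sz)
    ... | inj₂ refl = ¬Psz

  least-≤ : ∀ z → P z → ∃ λ m → IsLeast P m × m ≤ z
  least-≤ z Pz with least-≤-or-none z
  ... | inj₁ found = found
  ... | inj₂ none  = ⊥-elim (none z ≤-refl Pz)

module _ (G : Graph) where
  open Graph G using (n; adj)

  step-⊇ : ∀ F v → F v ≡ true → step G F v ≡ true
  step-⊇ F v Fv rewrite Fv = refl

  filledAfter-⊇ : ∀ t F v → F v ≡ true → filledAfter G t F v ≡ true
  filledAfter-⊇ zero    F v Fv = Fv
  filledAfter-⊇ (suc t) F v Fv = step-⊇ (filledAfter G t F) v (filledAfter-⊇ t F v Fv)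

  canForce-intro : ∀ F u v → F u ≡ true → Adj G u v →
                   (∀ w → Adj G u w → w ≢ v → F w ≡ true) → canForce G F u v ≡ true
  canForce-intro F u v Fu uv others rewrite Fu | uv = all-true _ (allFin n) unblocked
    where
    unblocked : ∀ w → (not (adj u w) ∨ ⌊ w ≟ v ⌋ ∨ F w) ≡ true
    unblocked w with adj u w in uw | w ≟ v
    ... | false | _       = refl
    ... | true  | yes _   = refl
    ... | true  | no w≢v = others w uw w≢v

  step-forced : ∀ F u v → canForce G F u v ≡ true → step G F v ≡ true
  step-forced F u v uv = trans (cong (F v ∨_) (any-true _ (∈-allFin u) uv)) (∨-zeroʳ (F v))

module _ (G : Graph) {T : ℕ} {s x : Vertex G → ℕ} {y : Vertex G → Vertex G → ℕ} {z : ℕ}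
         (feasible : FeasibleIM G T s x y z) where
  open Graph G using (n; adj)
  open FeasibleIM feasible

  C : VSet G
  C = supportSet G s

  Active : Vertex G → Vertex G → Set
  Active u v = Adj G u v × 0 < y u v

  active-before : ∀ {u v} → Active u v → x u < x v
  active-before {u} {v} (uv , active) = m+[1+k]*y≤k+n⇒m<n (x u) (x v) T active (c2 u v uv)

  active-neighbour-before : ∀ {u v w} → Active u v → Adj G u w → w ≢ v → x w < x v
  active-neighbour-before {u} {v} {w} (uv , active) uw w≢v =
    m+[1+k]*y≤k+n⇒m<n (x w) (x v) T active (c3 u v uv w uw w≢v)

  inSum-positive : ∀ v → s v ≡ 0 → 0 < inSum G y v
  inSum-positive v sv≡0 = subst (0 <_) (trans (sym (c1 v)) (cong (_+ inSum G y v) sv≡0)) ≤-refl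

  active-in-arc : ∀ v → s v ≡ 0 → ∃ λ u → Active u v
  active-in-arc v sv≡0
    with sum-map-positive (λ u → if adj u v then y u v else 0) (allFin n) (inSum-positive v sv≡0)
  ... | u , positive with adj u v in uv
  ...   | true  = u , uv , positive
  ...   | false = ⊥-elim (n≮0 positive)

  data Origin (v : Vertex G) : Set where
    seed     : C v ≡ true → Origin v
    forcedBy : (u : Vertex G) → Active u v → C v ≡ false → Origin v

  origin : ∀ v → Origin v
  origin v with s v in sv | s-bin v
  ... | zero        | _      = let u , active = active-in-arc v sv
                               in forcedBy u active (cong (_≡ᵇ 1) sv)
  ... | suc zero    | _      = seed (cong (_≡ᵇ 1) sv)
  ... | suc (suc _) | s≤s ()

  filled-by-time : ∀ t v → x v ≤ t → filledAfter G t C v ≡ true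
  filled-by-time t v _ with origin v
  ... | seed Cv = filledAfter-⊇ G t C v Cv
  filled-by-time zero v xv≤0 | forcedBy u active _ =
    ⊥-elim (n≮0 (<-≤-trans (active-before active) xv≤0))
  filled-by-time (suc t) v xv≤1+t | forcedBy u active@(uv , _) _ =
    step-forced G (filledAfter G t C) u v
      (canForce-intro G _ u v (earlier (active-before active)) uv
        (λ w uw w≢v → earlier (active-neighbour-before active uw w≢v)))
    where
    earlier : ∀ {w} → x w < x v → filledAfter G t C w ≡ true
    earlier xw<xv = filled-by-time t _ (≤-pred (<-≤-trans xw<xv xv≤1+t))

  fillTime-of : ∀ v → Origin v → ℕ
  fillTime-of v (seed _)         = 0
  fillTime-of v (forcedBy _ _ _) = x v

  fillTime-of≤x : ∀ v o → fillTime-of v o ≤ x v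
  fillTime-of≤x v (seed _)         = z≤n
  fillTime-of≤x v (forcedBy _ _ _) = ≤-refl

  fillTime : Vertex G → ℕ
  fillTime v = fillTime-of v (origin v)

  fillTime≤x : ∀ v → fillTime v ≤ x v
  fillTime≤x v = fillTime-of≤x v (origin v)

  fillTime-of≡0⇔seed : ∀ v o → fillTime-of v o ≡ 0 ⇔ C v ≡ true
  fillTime-of≡0⇔seed v (seed Cv) = mk⇔ (λ _ → Cv) (λ _ → refl)
  fillTime-of≡0⇔seed v (forcedBy u active ¬Cv) =
    mk⇔ (λ xv≡0 → ⊥-elim (n≮0 (subst (x u <_) xv≡0 (active-before active))))
        (λ Cv → ⊥-elim (not-¬ ¬Cv Cv))

  forcer-of : ∀ v o → 1 ≤ fillTime-of v o → Vertex G
  forcer-of v (forcedBy u _ _) _ = u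

  forcer-of-adj : ∀ v o (h : 1 ≤ fillTime-of v o) → Adj G (forcer-of v o h) v
  forcer-of-adj v (forcedBy u (uv , _) _) _ = uv

  forcer-of-before : ∀ v o (h : 1 ≤ fillTime-of v o) →
                     fillTime (forcer-of v o h) < fillTime-of v o
  forcer-of-before v (forcedBy u active _) _ =
    ≤-<-trans (fillTime≤x u) (active-before active)

  forcer-of-neighbour-before : ∀ v o (h : 1 ≤ fillTime-of v o) w →
                               Adj G (forcer-of v o h) w → w ≢ v → fillTime w < fillTime-of v o
  forcer-of-neighbour-before v (forcedBy u active _) _ w uw w≢v =
    ≤-<-trans (fillTime≤x w) (active-neighbour-before active uw w≢v)

  game : ZFGame G C
  game = record
    { τ           = fillTime
    ; initial     = λ v → fillTime-of≡0⇔seed v (origin v)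
    ; forcer      = λ v → forcer-of v (origin v)
    ; forcer-adj  = λ v → forcer-of-adj v (origin v)
    ; forcer-time = λ v → forcer-of-before v (origin v)
    ; forcer-nbrs = λ v → forcer-of-neighbour-before v (origin v)
    }

  allFilled-z : AllFilled G (filledAfter G z C)
  allFilled-z v = filled-by-time z v (c4 v)

  propagationTime≤z : ∃ λ p → IsPropagationTime G C p × p ≤ z
  propagationTime≤z = least-≤ allFilled? z allFilled-z
    where
    allFilled? : Decidable (λ t → AllFilled G (filledAfter G t C))
    allFilled? t = all? (λ v → filledAfter G t C v ≟ᵇ true)

theorem3p1 : (G : Graph) (T : ℕ) → 1 ≤ T →
    (s x : Vertex G → ℕ) (y : Vertex G → Vertex G → ℕ) (z : ℕ) →
    FeasibleIM G T s x y z →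
    IsZeroForcingSet G (supportSet G s)
    × Σ (ZFGame G (supportSet G s)) (λ g → InZ G T g)
    × ∃ (λ p → IsPropagationTime G (supportSet G s) p × p ≤ z × z ≤ T)
theorem3p1 G T _ s x y z feasible =
  let p , isPt , p≤z = propagationTime≤z G feasible in
  zeroForcing , (game G feasible , zeroForcing , withinT) , (p , isPt , p≤z , z-rng)
  where
  open FeasibleIM feasible using (x-rng; z-rng)

  zeroForcing : IsZeroForcingSet G (supportSet G s)
  zeroForcing = z , allFilled-z G feasible

  withinT : ∀ v → fillTime G feasible v ≤ T
  withinT v = ≤-trans (fillTime≤x G feasible v) (x-rng v)
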